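{- Let $m$ be a positive integer and let $M$ be a nonempty subset of $\{1, \ldots, m\}$. For each integer $n \ge 0$ let $a(n)$ be the number of $n$-color compositions of $n$ in which every color $c$ satisfies $c \equiv r \pmod m$ for some $r \in M$, and set $a(n) = 0$ for $n \le -1$. Let $M' = M$ if $1 \notin M$ and $M' = M \cup \{m+1\}$ if $1 \in M$. Then for $0 \le n \le m+1$, $a(n)$ equals the number of $n$-color compositions of $n$ all of whose colors lie in $M'$, and for every integer $n \ge m+2$, \[ a(n) = a(n-1) + a(n-m) - a(n-m-1) + \sum_{r \in M} a(n-r). \]
   Context: An $n$-color composition of a positive integer $n$ is a finite sequence of parts $(\kappa^{(1)}_{c_1}, \ldots, \kappa^{(r)}_{c_r})$, where $\kappa^{(1)}, \ldots, \kappa^{(r)}$ are positive integers with sum $n$ and each part $\kappa^{(j)}$ carries a color $c_j \in \{1, \ldots, \kappa^{(j)}\}$; two such compositions are the same iff they have the same sequence of (part, color) pairs. By convention there is exactly one (empty) composition of $0$. -}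

module Defs where

open import Data.Nat using (ℕ; zero; suc; _+_; NonZero; _%_)
open import Data.Fin using (Fin; toℕ)
import Data.Fin as Fin
open import Data.Fin.Subset using (Subset; _∈_)
open import Data.Product using (Σ-syntax; _×_)
open import Data.Sum using (_⊎_)
open import Data.List using (List; map)
open import Data.Nat.ListAction using (sum)
open import Data.Unit using (⊤)
open import Data.Fin.Subset.Properties using (_∈?_)
open import Data.List using (allFin)
open import Data.Bool using (if_then_else_)
open import Relation.Nullary.Decidable using (does)
open import Relation.Binary.PropositionalEquality using (_≡_)

-- An n-color composition of n.  A part is  suc k  (a positive integer) and
-- its colour is  suc (toℕ c)  for  c : Fin (suc k), i.e. a colour in {1,…,suc k}.
data Comp : ℕ → Set where
  []   : Comp zero
  cons : ∀ {n} (k : ℕ) (c : Fin (suc k)) → Comp n → Comp (suc k + n)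

colour : ∀ {k} → Fin (suc k) → ℕ
colour c = suc (toℕ c)

AllColours : (ℕ → Set) → ∀ {n} → Comp n → Set
AllColours P []           = ⊤
AllColours P (cons k c w) = P (colour c) × AllColours P w

-- M ⊆ {1,…,m} is encoded as  M : Subset m ; index i : Fin m stands for r = suc (toℕ i).

ModCond : (m : ℕ) .{{_ : NonZero m}} → Subset m → ℕ → Set
ModCond m M c = Σ[ i ∈ Fin m ] (i ∈ M × c % m ≡ suc (toℕ i) % m)

InM' : (m : ℕ) → Subset m → ℕ → Set
InM' zero    M c = Σ[ i ∈ Fin zero ] (i ∈ M × c ≡ suc (toℕ i))
InM' (suc m) M c =
  (Σ[ i ∈ Fin (suc m) ] (i ∈ M × c ≡ suc (toℕ i)))
  ⊎ (Fin.zero ∈ M × c ≡ suc (suc m))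

sumOver : (m : ℕ) → Subset m → (ℕ → ℕ) → ℕ
sumOver m M f = sum (map (λ i → if does (i ∈? M) then f (suc (toℕ i)) else 0) (allFin m))

-- Encode an n-color composition as a list of parts, a part of size c + t + 1 carrying
-- colour c + 1.  Lowering t by one in the first part maps the compositions of n + 2
-- with t > 0 bijectively onto those of n + 1; the others are the compositions whose
-- first part carries its largest colour (t = 0).  Among the latter, a first part c + 1 > m can be
-- shortened by m without leaving the allowed colours, which are m-periodic; a first
-- part c + 1 ≤ m is an element r of M followed by a composition of n - r.  Counting
-- both sides gives a(n) - a(n-1) = a(n-m) - a(n-m-1) + Σ_{r ∈ M} a(n-r).  For
-- n ≤ m + 1 all colours are at most m + 1, and there the two colour conditions agree.
module Submission where

open import Defs
open import Data.Bool using (if_then_else_)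
open import Data.Fin as Fin using (Fin; toℕ; fromℕ<)
open import Data.Fin.Permutation using (↔⇒≡)
open import Data.Fin.Properties using (toℕ-injective; toℕ<n; toℕ-fromℕ<; fromℕ<-toℕ; +↔⊎)
open import Data.Fin.Subset using (Subset; Nonempty; _∈_)
open import Data.Fin.Subset.Properties using (_∈?_)
open import Data.Integer using (ℤ; +_) renaming (_+_ to _+ℤ_; _-_ to _-ℤ_)
import Data.Integer.Tactic.RingSolver as ℤ-Solver
open import Data.List using (List; []; _∷_; tabulate)
open import Data.List.Properties using (map-tabulate)
open import Data.Nat
open import Data.Nat.DivMod using ([m+n]%n≡m%n; m<n⇒m%n≡m; n%n≡0)
open import Data.Nat.ListAction using (sum)
open import Data.Nat.Properties
import Data.Nat.Tactic.RingSolver as ℕ-Solver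
open import Data.Product using (Σ; Σ-syntax; _×_; _,_; proj₁; proj₂)
open import Data.Product.Function.Dependent.Propositional using (congˡ)
open import Data.Product.Function.NonDependent.Propositional using (_×-↔_)
open import Data.Sum using (_⊎_; inj₁; inj₂)
open import Data.Sum.Algebra using (⊎-assoc; ⊎-comm)
open import Data.Sum.Function.Propositional using (_⊎-↔_)
open import Data.Unit using (tt)
open import Data.Vec.Properties.WithK using ([]=-irrelevant)
open import Function using (_∘_)
open import Function.Bundles using (_↔_; _⇔_; mk↔ₛ′; mk⇔; Equivalence)
open import Function.Construct.Composition using (_↔-∘_)
open import Function.Properties.Inverse using (↔-refl; ↔-sym)
open import Function.Related.Propositional using (bijection; module EquationalReasoning)
open import Level using (0ℓ)
open import Relation.Binary.PropositionalEquality
open import Relation.Nullary using (yes; no; does; Irrelevant; contradiction)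

⇔⇒↔ : {A B : Set} → Irrelevant A → Irrelevant B → A ⇔ B → A ↔ B
⇔⇒↔ A-irr B-irr A⇔B = mk↔ₛ′ to from (λ _ → B-irr _ _) (λ _ → A-irr _ _)
  where open Equivalence A⇔B

Σ-Fin-suc↔ : ∀ {n} {B : Fin (suc n) → Set} →
             Σ (Fin (suc n)) B ↔ (B Fin.zero ⊎ Σ (Fin n) (B ∘ Fin.suc))
Σ-Fin-suc↔ = mk↔ₛ′
  (λ { (Fin.zero , b) → inj₁ b ; (Fin.suc i , b) → inj₂ (i , b) })
  (λ { (inj₁ b) → Fin.zero , b ; (inj₂ (i , b)) → Fin.suc i , b })
  (λ { (inj₁ b) → refl ; (inj₂ (i , b)) → refl })
  (λ { (Fin.zero , b) → refl ; (Fin.suc i , b) → refl })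

Fin-sum-tabulate↔Σ : ∀ n (h : Fin n → ℕ) → Fin (sum (tabulate h)) ↔ (Σ[ i ∈ Fin n ] Fin (h i))
Fin-sum-tabulate↔Σ zero    h = mk↔ₛ′ (λ ()) (λ ()) (λ ()) (λ ())
Fin-sum-tabulate↔Σ (suc n) h =
  ↔-sym Σ-Fin-suc↔ ↔-∘ ((↔-refl ⊎-↔ Fin-sum-tabulate↔Σ n (h ∘ Fin.suc)) ↔-∘ +↔⊎)

Fin-if-∈↔ : ∀ {m} (M : Subset m) (i : Fin m) x →
            Fin (if does (i ∈? M) then x else 0) ↔ (i ∈ M × Fin x)
Fin-if-∈↔ M i x with i ∈? M
... | yes i∈M = mk↔ₛ′ (i∈M ,_) proj₂ (λ { (i∈M′ , _) → cong (_, _) ([]=-irrelevant i∈M i∈M′) })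
                      (λ _ → refl)
... | no  i∉M = mk↔ₛ′ (λ ()) (λ { (i∈M , _) → contradiction i∈M i∉M })
                      (λ { (i∈M , _) → contradiction i∈M i∉M }) (λ ())

Fin-sumOver↔Σ : ∀ m (M : Subset m) (f : ℕ → ℕ) →
                Fin (sumOver m M f) ↔ (Σ[ i ∈ Fin m ] (i ∈ M × Fin (f (suc (toℕ i)))))
Fin-sumOver↔Σ m M f =
  congˡ (Fin-if-∈↔ M _ _)
  ↔-∘ subst (λ xs → Fin (sum xs) ↔ (Σ[ i ∈ Fin m ] Fin (term i)))
            (sym (map-tabulate (λ i → i) term)) (Fin-sum-tabulate↔Σ m term)
  where
  term : Fin m → ℕ
  term i = if does (i ∈? M) then f (suc (toℕ i)) else 0

Coloured : (ℕ → Set) → ℕ → Set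
Coloured P n = Σ[ w ∈ Comp n ] AllColours P w

AllColours-cong : ∀ {P Q : ℕ → Set} {B} → (∀ c → suc c ≤ B → P (suc c) ↔ Q (suc c)) →
                  ∀ {n} (w : Comp n) → n ≤ B → AllColours P w ↔ AllColours Q w
AllColours-cong P↔Q []           _   = ↔-refl
AllColours-cong P↔Q (cons k c w) n≤B =
  P↔Q (toℕ c) (≤-trans (≤-trans (toℕ<n c) (m≤m+n (suc k) _)) n≤B)
  ×-↔ AllColours-cong P↔Q w (≤-trans (m≤n+m _ (suc k)) n≤B)

Coloured-cong : ∀ {P Q : ℕ → Set} {B} → (∀ c → suc c ≤ B → P (suc c) ↔ Q (suc c)) →
                ∀ {n} → n ≤ B → Coloured P n ↔ Coloured Q n
Coloured-cong P↔Q n≤B = congˡ (λ {w} → AllColours-cong P↔Q w n≤B)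

module ColourLists (P : ℕ → Set) (P-irrelevant : ∀ c → Irrelevant (P c)) where

  -- (c , t , p) stands for the part c + t + 1 with colour c + 1.
  Part : Set
  Part = Σ[ c ∈ ℕ ] Σ[ t ∈ ℕ ] P (suc c)

  size : List Part → ℕ
  size []                = 0
  size ((c , t , _) ∷ l) = suc (c + t) + size l

  ColourList : ℕ → Set
  ColourList n = Σ[ l ∈ List Part ] (size l ≡ n)

  ColourList-≡ : ∀ {n l l′} {e : size l ≡ n} {e′ : size l′ ≡ n} →
                 l ≡ l′ → _≡_ {A = ColourList n} (l , e) (l′ , e′)
  ColourList-≡ {e = e} {e′} refl = cong (_ ,_) (≡-irrelevant e e′)

  Part-≡ : ∀ {c c′ t t′} {p : P (suc c)} {p′ : P (suc c′)} →
           c ≡ c′ → t ≡ t′ → _≡_ {A = Part} (c , t , p) (c′ , t′ , p′)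
  Part-≡ {p = p} {p′} refl refl = cong (λ q → _ , _ , q) (P-irrelevant _ p p′)

  _∷ᶜ_ : ∀ {k n} → Σ[ c ∈ Fin (suc k) ] P (colour c) → Coloured P n → Coloured P (suc k + n)
  (c , p) ∷ᶜ (w , ps) = cons _ c w , p , ps

  ∷ᶜ-subst : ∀ {k k′ n n′} {c : Fin (suc k)} {c′ : Fin (suc k′)}
             {p : P (colour c)} {p′ : P (colour c′)} {x : Coloured P n} {x′ : Coloured P n′}
             (e : suc k + n ≡ suc k′ + n′) (en : n ≡ n′) → k ≡ k′ → toℕ c ≡ toℕ c′ →
             subst (Coloured P) en x ≡ x′ →
             subst (Coloured P) e ((c , p) ∷ᶜ x) ≡ (c′ , p′) ∷ᶜ x′
  ∷ᶜ-subst {p = p} {p′} e refl refl c≡c′ refl with toℕ-injective c≡c′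
  ... | refl rewrite ≡-irrelevant e refl | P-irrelevant _ p p′ = refl

  toColourList : ∀ {n} → Coloured P n → ColourList n
  toColourList ([] , _) = [] , refl
  toColourList (cons k c w , p , ps) with toColourList (w , ps)
  ... | l , e = (toℕ c , k ∸ toℕ c , p) ∷ l ,
                cong₂ (λ k′ n → suc k′ + n) (m+[n∸m]≡n (s≤s⁻¹ (toℕ<n c))) e

  fromColourList : (l : List Part) → Coloured P (size l)
  fromColourList []                = [] , tt
  fromColourList ((c , t , p) ∷ l) = (fromℕ< c<c+t+1 , p′) ∷ᶜ fromColourList l
    where
    c<c+t+1 : c < suc (c + t)
    c<c+t+1 = s≤s (m≤m+n c t)
    p′ : P (suc (toℕ (fromℕ< c<c+t+1)))
    p′ = subst (P ∘ suc) (sym (toℕ-fromℕ< c<c+t+1)) p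

  toColourList-fromColourList : ∀ l → proj₁ (toColourList (fromColourList l)) ≡ l
  toColourList-fromColourList [] = refl
  toColourList-fromColourList ((c , t , p) ∷ l)
    with toColourList (fromColourList l) | toColourList-fromColourList l
  ... | l′ , _ | refl = cong (_∷ l′) (Part-≡ i≡c (trans (cong (c + t ∸_) i≡c) (m+n∸m≡n c t)))
    where i≡c = toℕ-fromℕ< (s≤s (m≤m+n c t))

  fromColourList-toColourList : ∀ {n} (x : Coloured P n) →
    subst (Coloured P) (proj₂ (toColourList x)) (fromColourList (proj₁ (toColourList x))) ≡ x
  fromColourList-toColourList ([] , tt) = refl
  fromColourList-toColourList (cons k c w , p , ps)
    with toColourList (w , ps) | fromColourList-toColourList (w , ps)
  ... | l , e | ih = ∷ᶜ-subst _ e (m+[n∸m]≡n (s≤s⁻¹ (toℕ<n c))) (toℕ-fromℕ< _) ih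

  Coloured↔ColourList : ∀ {n} → Coloured P n ↔ ColourList n
  Coloured↔ColourList = mk↔ₛ′ toColourList (λ (l , e) → subst (Coloured P) e (fromColourList l))
    (λ { (l , refl) → ColourList-≡ (toColourList-fromColourList l) })
    fromColourList-toColourList

  -- Compositions of N whose first part carries its largest colour c + 1, that part
  -- being split off.
  MaxFirst : ℕ → Set
  MaxFirst N = Σ[ c ∈ ℕ ] (P (suc c) × Σ[ l ∈ List Part ] (suc c + size l ≡ N))

  MaxFirst-≡ : ∀ {N c c′} {p : P (suc c)} {p′ : P (suc c′)} {l l′}
               {e : suc c + size l ≡ N} {e′ : suc c′ + size l′ ≡ N} →
               c ≡ c′ → l ≡ l′ → _≡_ {A = MaxFirst N} (c , p , l , e) (c′ , p′ , l′ , e′)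
  MaxFirst-≡ {p = p} {p′} {e = e} {e′} refl refl
    rewrite P-irrelevant _ p p′ | ≡-irrelevant e e′ = refl

  ColourList-suc-suc↔ : ∀ n →
    ColourList (suc (suc n)) ↔ (ColourList (suc n) ⊎ MaxFirst (suc (suc n)))
  ColourList-suc-suc↔ n = mk↔ₛ′ lower raise
    (λ { (inj₁ ([] , ())) ; (inj₁ (_ ∷ _ , _)) → cong inj₁ (ColourList-≡ refl)
       ; (inj₂ _) → cong inj₂ (MaxFirst-≡ refl refl) })
    (λ { ([] , ()) ; ((_ , zero , _) ∷ _ , _) → ColourList-≡ refl
       ; ((_ , suc _ , _) ∷ _ , _) → ColourList-≡ refl })
    where
    lower : ColourList (suc (suc n)) → ColourList (suc n) ⊎ MaxFirst (suc (suc n))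
    lower ([] , ())
    lower ((c , zero , p) ∷ l , e) =
      inj₂ (c , p , l , trans (cong (λ c′ → suc c′ + size l) (sym (+-identityʳ c))) e)
    lower ((c , suc t , p) ∷ l , e) =
      inj₁ ((c , t , p) ∷ l ,
            suc-injective (trans (cong (λ c′ → suc c′ + size l) (sym (+-suc c t))) e))

    raise : ColourList (suc n) ⊎ MaxFirst (suc (suc n)) → ColourList (suc (suc n))
    raise (inj₁ ([] , ()))
    raise (inj₁ ((c , t , p) ∷ l , e)) =
      (c , suc t , p) ∷ l , trans (cong (λ c′ → suc c′ + size l) (+-suc c t)) (cong suc e)
    raise (inj₂ (c , p , l , e)) =
      (c , zero , p) ∷ l , trans (cong (λ c′ → suc c′ + size l) (+-identityʳ c)) e

  -- Compositions of N whose first part i + 1 ≤ m carries its largest colour, that part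
  -- being split off.
  SmallFirst : ℕ → ℕ → Set
  SmallFirst m N = Σ[ i ∈ Fin m ] (P (suc (toℕ i)) × ColourList (N ∸ suc (toℕ i)))

  SmallFirst-≡ : ∀ {m N i i′} {p : P (suc (toℕ i))} {p′ : P (suc (toℕ i′))} {l l′}
                 {e : size l ≡ N ∸ suc (toℕ i)} {e′ : size l′ ≡ N ∸ suc (toℕ i′)} →
                 i ≡ i′ → l ≡ l′ → _≡_ {A = SmallFirst m N} (i , p , l , e) (i′ , p′ , l′ , e′)
  SmallFirst-≡ {p = p} {p′} {e = e} {e′} refl refl
    rewrite P-irrelevant _ p p′ | ≡-irrelevant e e′ = refl

  module Periodic (m : ℕ) (periodic : ∀ c → P (suc (c + m)) ⇔ P (suc c)) where

    MaxFirst-+↔ : ∀ N → MaxFirst (N + m) ↔ (MaxFirst N ⊎ SmallFirst m (N + m))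
    MaxFirst-+↔ N = mk↔ₛ′ reduce enlarge reduce-enlarge enlarge-reduce
      where
      size-+ : ∀ c s m → suc (c + m) + s ≡ suc c + s + m
      size-+ = ℕ-Solver.solve-∀

      reduce : MaxFirst (N + m) → MaxFirst N ⊎ SmallFirst m (N + m)
      reduce (c , p , l , e) with c <? m
      ... | yes c<m = inj₂ (fromℕ< c<m , subst (P ∘ suc) (sym i≡c) p , l ,
                            trans (sym (m+n∸m≡n (suc c) (size l)))
                                  (cong₂ _∸_ e (cong suc (sym i≡c))))
        where i≡c = toℕ-fromℕ< c<m
      ... | no  c≮m = inj₁ (c ∸ m , Equivalence.to (periodic (c ∸ m)) p′ , l ,
                            +-cancelʳ-≡ m _ _ (trans (sym (size-+ (c ∸ m) (size l) m))
                                                     (trans (cong (λ c′ → suc c′ + size l) c∸m+m≡c) e)))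
        where
        c∸m+m≡c : c ∸ m + m ≡ c
        c∸m+m≡c = m∸n+n≡m (≮⇒≥ c≮m)
        p′ : P (suc (c ∸ m + m))
        p′ = subst (P ∘ suc) (sym c∸m+m≡c) p

      enlarge : MaxFirst N ⊎ SmallFirst m (N + m) → MaxFirst (N + m)
      enlarge (inj₁ (c , p , l , e)) =
        c + m , Equivalence.from (periodic c) p , l , trans (size-+ c (size l) m) (cong (_+ m) e)
      enlarge (inj₂ (i , p , l , e)) =
        toℕ i , p , l ,
        trans (cong (_+_ (suc (toℕ i))) e) (m+[n∸m]≡n (≤-trans (toℕ<n i) (m≤n+m m N)))

      reduce-enlarge : ∀ y → reduce (enlarge y) ≡ y
      reduce-enlarge (inj₁ (c , _)) with c + m <? m
      ... | yes c+m<m = contradiction c+m<m (≤⇒≯ (m≤n+m m c))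
      ... | no  _     = cong inj₁ (MaxFirst-≡ (m+n∸n≡m c m) refl)
      reduce-enlarge (inj₂ (i , _)) with toℕ i <? m
      ... | yes i<m = cong inj₂ (SmallFirst-≡ {N = N + m} (fromℕ<-toℕ i i<m) refl)
      ... | no  i≮m = contradiction (toℕ<n i) i≮m

      enlarge-reduce : ∀ x → enlarge (reduce x) ≡ x
      enlarge-reduce (c , _) with c <? m
      ... | yes c<m = MaxFirst-≡ (toℕ-fromℕ< c<m) refl
      ... | no  c≮m = MaxFirst-≡ (m∸n+n≡m (≮⇒≥ c≮m)) refl

    ColourList-recurrence↔ : ∀ k →
      (ColourList (suc (suc k) + m) ⊎ ColourList (suc k))
      ↔ (ColourList (suc k + m) ⊎ (ColourList (suc (suc k)) ⊎ SmallFirst m (suc (suc k) + m)))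
    ColourList-recurrence↔ k = begin
      (ColourList (2+k + m) ⊎ ColourList (suc k))
        ↔⟨ ColourList-suc-suc↔ (k + m) ⊎-↔ ↔-refl ⟩
      ((ColourList (suc k + m) ⊎ MaxFirst (2+k + m)) ⊎ ColourList (suc k))
        ↔⟨ ⊎-assoc 0ℓ _ _ _ ⟩
      (ColourList (suc k + m) ⊎ (MaxFirst (2+k + m) ⊎ ColourList (suc k)))
        ↔⟨ ↔-refl ⊎-↔ (MaxFirst-+↔ 2+k ⊎-↔ ↔-refl) ⟩
      (ColourList (suc k + m) ⊎ ((MaxFirst 2+k ⊎ Small) ⊎ ColourList (suc k)))
        ↔⟨ ↔-refl ⊎-↔ ⊎-comm _ _ ⟩
      (ColourList (suc k + m) ⊎ (ColourList (suc k) ⊎ (MaxFirst 2+k ⊎ Small)))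
        ↔⟨ ↔-refl ⊎-↔ ⊎-assoc 0ℓ _ _ _ ⟨
      (ColourList (suc k + m) ⊎ ((ColourList (suc k) ⊎ MaxFirst 2+k) ⊎ Small))
        ↔⟨ ↔-refl ⊎-↔ (↔-sym (ColourList-suc-suc↔ k) ⊎-↔ ↔-refl) ⟩
      (ColourList (suc k + m) ⊎ (ColourList 2+k ⊎ Small)) ∎
      where
      open EquationalReasoning {k = bijection}
      2+k = suc (suc k)
      Small = SmallFirst m (2+k + m)

    recurrence : (a : ℕ → ℕ) → (∀ n → Fin (a n) ↔ ColourList n) →
      ∀ k s → Fin s ↔ SmallFirst m (suc (suc k) + m) →
      a (suc (suc k) + m) + a (suc k) ≡ a (suc k + m) + (a (suc (suc k)) + s)
    recurrence a a↔ k s s↔ = ↔⇒≡ (begin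
      Fin (a (2+k + m) + a (suc k))
        ↔⟨ +↔⊎ ⟩
      (Fin (a (2+k + m)) ⊎ Fin (a (suc k)))
        ↔⟨ a↔ _ ⊎-↔ a↔ _ ⟩
      (ColourList (2+k + m) ⊎ ColourList (suc k))
        ↔⟨ ColourList-recurrence↔ k ⟩
      (ColourList (suc k + m) ⊎ (ColourList 2+k ⊎ SmallFirst m (2+k + m)))
        ↔⟨ a↔ _ ⊎-↔ (a↔ _ ⊎-↔ s↔) ⟨
      (Fin (a (suc k + m)) ⊎ (Fin (a 2+k) ⊎ Fin s))
        ↔⟨ ↔-refl ⊎-↔ +↔⊎ ⟨
      (Fin (a (suc k + m)) ⊎ Fin (a 2+k + s))
        ↔⟨ +↔⊎ ⟨
      Fin (a (suc k + m) + (a 2+k + s)) ∎)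
      where
      open EquationalReasoning {k = bijection}
      2+k = suc (suc k)

module _ {m : ℕ} .{{_ : NonZero m}} where

  suc-%-cases : ∀ {x} → x < m → suc x % m ≡ suc x ⊎ suc x ≡ m
  suc-%-cases x<m with m≤n⇒m<n∨m≡n x<m
  ... | inj₁ x+1<m = inj₁ (m<n⇒m%n≡m x+1<m)
  ... | inj₂ x+1≡m = inj₂ x+1≡m

  suc-%-injective : ∀ {x y} → x < m → y < m → suc x % m ≡ suc y % m → x ≡ y
  suc-%-injective {x} {y} x<m y<m e with suc-%-cases x<m | suc-%-cases y<m
  ... | inj₁ ex | inj₁ ey = suc-injective (trans (sym ex) (trans e ey))
  ... | inj₂ ex | inj₂ ey = suc-injective (trans ex (sym ey))
  ... | inj₁ ex | inj₂ ey with () ← trans (sym ex) (trans e (trans (cong (_% m) ey) (n%n≡0 m)))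
  ... | inj₂ ex | inj₁ ey with () ← trans (sym ey) (trans (sym e) (trans (cong (_% m) ex) (n%n≡0 m)))

module _ (m : ℕ) .{{_ : NonZero m}} (M : Subset m) where

  ModCond-irrelevant : ∀ c → Irrelevant (ModCond m M c)
  ModCond-irrelevant c (j , j∈M , e) (j′ , j′∈M , e′)
    with toℕ-injective (suc-%-injective (toℕ<n j) (toℕ<n j′) (trans (sym e) e′))
  ... | refl rewrite []=-irrelevant j∈M j′∈M | ≡-irrelevant e e′ = refl

  ModCond-periodic : ∀ c → ModCond m M (suc (c + m)) ⇔ ModCond m M (suc c)
  ModCond-periodic c = mk⇔ (λ (j , j∈M , e) → j , j∈M , trans (sym period) e)
                          (λ (j , j∈M , e) → j , j∈M , trans period e)
    where period = [m+n]%n≡m%n (suc c) m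

  ModCond↔∈ : ∀ (i : Fin m) → ModCond m M (suc (toℕ i)) ↔ i ∈ M
  ModCond↔∈ i = ⇔⇒↔ (ModCond-irrelevant _) []=-irrelevant (mk⇔
    (λ (j , j∈M , e) →
       subst (_∈ M) (toℕ-injective (suc-%-injective (toℕ<n j) (toℕ<n i) (sym e))) j∈M)
    (λ i∈M → i , i∈M , refl))

  open ColourLists (ModCond m M) ModCond-irrelevant using (ColourList; SmallFirst)

  Fin-sumOver↔SmallFirst : ∀ (a : ℕ → ℕ) N → (∀ n → Fin (a n) ↔ ColourList n) →
    Fin (sumOver m M (λ r → a (N ∸ r))) ↔ SmallFirst m N
  Fin-sumOver↔SmallFirst a N a↔ =
    congˡ (↔-sym (ModCond↔∈ _) ×-↔ a↔ _) ↔-∘ Fin-sumOver↔Σ m M (λ r → a (N ∸ r))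

module _ (m-1 : ℕ) (M : Subset (suc m-1)) where

  InM′-irrelevant : ∀ c → Irrelevant (InM' (suc m-1) M c)
  InM′-irrelevant c (inj₁ (i , i∈M , e)) (inj₁ (i′ , i′∈M , e′))
    with toℕ-injective (suc-injective (trans (sym e) e′))
  ... | refl rewrite []=-irrelevant i∈M i′∈M | ≡-irrelevant e e′ = refl
  InM′-irrelevant c (inj₁ (i , _ , e)) (inj₂ (_ , e′)) =
    contradiction (suc-injective (trans (sym e) e′)) (<⇒≢ (toℕ<n i))
  InM′-irrelevant c (inj₂ (_ , e)) (inj₁ (i′ , _ , e′)) =
    contradiction (suc-injective (trans (sym e′) e)) (<⇒≢ (toℕ<n i′))
  InM′-irrelevant c (inj₂ (0∈M , e)) (inj₂ (0∈M′ , e′))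
    rewrite []=-irrelevant 0∈M 0∈M′ | ≡-irrelevant e e′ = refl

  ModCond⇔InM′ : ∀ c → suc c ≤ suc m-1 + 1 → ModCond (suc m-1) M (suc c) ⇔ InM' (suc m-1) M (suc c)
  ModCond⇔InM′ c c<m+1 = mk⇔ to from
    where
    m+1≡1[mod] : suc (suc m-1) % suc m-1 ≡ 1 % suc m-1
    m+1≡1[mod] = [m+n]%n≡m%n 1 (suc m-1)

    to : ModCond (suc m-1) M (suc c) → InM' (suc m-1) M (suc c)
    to (j , j∈M , e) with c <? suc m-1
    ... | yes c<m = inj₁ (j , j∈M , cong suc (suc-%-injective c<m (toℕ<n j) e))
    ... | no  c≮m with ≤-antisym (s≤s⁻¹ (subst (suc c ≤_) (+-comm (suc m-1) 1) c<m+1)) (≮⇒≥ c≮m)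
    ... | refl = inj₂ (subst (_∈ M) j≡0 j∈M , refl)
      where
      j≡0 : j ≡ Fin.zero
      j≡0 = toℕ-injective (sym (suc-%-injective z<s (toℕ<n j) (trans (sym m+1≡1[mod]) e)))

    from : InM' (suc m-1) M (suc c) → ModCond (suc m-1) M (suc c)
    from (inj₁ (i , i∈M , e)) = i , i∈M , cong (_% suc m-1) e
    from (inj₂ (0∈M , e))     = Fin.zero , 0∈M , trans (cong (_% suc m-1) e) m+1≡1[mod]

ModCond↔InM′ : (m : ℕ) .{{_ : NonZero m}} (M : Subset m) →
              ∀ c → suc c ≤ m + 1 → ModCond m M (suc c) ↔ InM' m M (suc c)
ModCond↔InM′ (suc m-1) M c c<m+1 =
  ⇔⇒↔ (ModCond-irrelevant (suc m-1) M (suc c)) (InM′-irrelevant m-1 M (suc c))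
      (ModCond⇔InM′ m-1 M c c<m+1)

ℕ-identity⇒ℤ : ∀ {A B C D S : ℕ} → A + D ≡ B + (C + S) → + A ≡ ((+ B +ℤ + C) -ℤ + D) +ℤ + S
ℕ-identity⇒ℤ {A} {B} {C} {D} {S} eq = begin
  + A                              ≡⟨ add-sub (+ A) (+ D) ⟩
  (+ A +ℤ + D) -ℤ + D              ≡⟨ cong (λ z → + z -ℤ + D) eq ⟩
  (+ B +ℤ (+ C +ℤ + S)) -ℤ + D     ≡⟨ regroup (+ B) (+ C) (+ D) (+ S) ⟩
  ((+ B +ℤ + C) -ℤ + D) +ℤ + S     ∎
  where
  open ≡-Reasoning
  add-sub : ∀ (x y : ℤ) → x ≡ (x +ℤ y) -ℤ y
  add-sub = ℤ-Solver.solve-∀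
  regroup : ∀ (x y z w : ℤ) → (x +ℤ (y +ℤ w)) -ℤ z ≡ ((x +ℤ y) -ℤ z) +ℤ w
  regroup = ℤ-Solver.solve-∀

theorem3 : (m : ℕ) .{{_ : NonZero m}} (M : Subset m) → Nonempty M →
    (a b : ℕ → ℕ) →
    (∀ n → Fin (a n) ↔ (Σ[ w ∈ Comp n ] AllColours (ModCond m M) w)) →
    (∀ n → Fin (b n) ↔ (Σ[ w ∈ Comp n ] AllColours (InM' m M) w)) →
    (∀ n → n ≤ m + 1 → a n ≡ b n)
    × (∀ n → m + 2 ≤ n →
        + a n ≡ ((+ a (n ∸ 1) +ℤ + a (n ∸ m)) -ℤ + a (n ∸ (m + 1)))
                  +ℤ + sumOver m M (λ r → a (n ∸ r)))
theorem3 m M _ a b a↔ b↔ = small , large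
  where
  open ColourLists (ModCond m M) (ModCond-irrelevant m M)
  open Periodic m (ModCond-periodic m M)

  small : ∀ n → n ≤ m + 1 → a n ≡ b n
  small n n≤m+1 = ↔⇒≡ (↔-sym (b↔ n) ↔-∘ (Coloured-cong (ModCond↔InM′ m M) n≤m+1 ↔-∘ a↔ n))

  Goal : ℕ → Set
  Goal n = + a n ≡ ((+ a (n ∸ 1) +ℤ + a (n ∸ m)) -ℤ + a (n ∸ (m + 1)))
                     +ℤ + sumOver m M (λ r → a (n ∸ r))

  a↔ColourList : ∀ n → Fin (a n) ↔ ColourList n
  a↔ColourList n = Coloured↔ColourList ↔-∘ a↔ n

  large-at : ∀ k → Goal (suc (suc k) + m)
  large-at k rewrite m+n∸n≡m (suc (suc k)) m | +-comm m 1 | m+n∸n≡m (suc k) m =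
    ℕ-identity⇒ℤ {B = a (suc k + m)} {C = a (suc (suc k))}
      (recurrence a a↔ColourList k _ (Fin-sumOver↔SmallFirst m M a (suc (suc k) + m) a↔ColourList))

  large : ∀ n → m + 2 ≤ n → Goal n
  large n m+2≤n with k , refl ← m≤n⇒∃[o]m+o≡n m+2≤n = subst Goal (reorder k m) (large-at k)
    where
    reorder : ∀ k m → suc (suc k) + m ≡ m + 2 + k
    reorder = ℕ-Solver.solve-∀
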